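{- Let $A$ be a maximal $S_h$-linear set in $\mathbb{F}_q^r$ with $2h<r\leq|A|$. Then $A$ contains a basis of $\mathbb{F}_q^r$ as a vector space over $\mathbb{F}_q$.
   Context: For a non-empty subset $A$ of $\mathbb{F}_q^r$ and a positive integer $h\leq|A|$, an $h$-linear combination of $A$ is an expression $\lambda_1\boldsymbol{a}_1+\cdots+\lambda_h\boldsymbol{a}_h$ with $\lambda_i\in\mathbb{F}_q^*$ and $\boldsymbol{a}_1,\dots,\boldsymbol{a}_h$ distinct elements of $A$. $A$ is an $S_h$-linear set if all $h$-linear combinations of elements of $A$, omitting permutations of the summands, yield distinct elements of $\mathbb{F}_q^r$. An $S_h$-linear set $M$ is maximal if for every $S_h$-linear set $A$ with $M\subseteq A\subseteq\mathbb{F}_q^r$ one has $M=A$. -}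

module Defs where

open import Level using (Level; _⊔_) renaming (suc to lsuc)
open import Data.Nat using (ℕ; zero; suc; _≤_)
open import Data.Fin using (Fin)
import Data.Fin as Fin
open import Data.Fin.Subset using (Subset; _∈_; _∉_; ∣_∣)
open import Data.Product using (Σ; ∃; _×_)
open import Relation.Nullary using (¬_)
open import Relation.Binary.PropositionalEquality as ≡ using (_≡_)
open import Algebra.Bundles using (CommutativeRing)
open import Function.Bundles using (Inverse)

record FiniteField (c ℓ : Level) : Set (lsuc (c ⊔ ℓ)) where
  field
    commRing : CommutativeRing c ℓ
  open CommutativeRing commRing public
  field
    0≉1     : ¬ (0# ≈ 1#)
    inverse : ∀ x → ¬ (x ≈ 0#) → ∃ λ y → x * y ≈ 1#
    q       : ℕ
    enum    : Inverse setoid (≡.setoid (Fin q))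

module FF {c ℓ : Level} (F : FiniteField c ℓ) where
  open FiniteField F

  Vect : ℕ → Set c
  Vect r = Fin r → Carrier

  _≈ᵥ_ : ∀ {r} → Vect r → Vect r → Set ℓ
  u ≈ᵥ v = ∀ j → u j ≈ v j

  zeroᵥ : ∀ {r} → Vect r
  zeroᵥ _ = 0#

  sumF : ∀ n → (Fin n → Carrier) → Carrier
  sumF zero    f = 0#
  sumF (suc n) f = f Fin.zero + sumF n (λ i → f (Fin.suc i))

  lincomb : ∀ {n r} → (Fin n → Carrier) → (Fin n → Vect r) → Vect r
  lincomb {n} c a j = sumF n (λ i → c i * a i j)

  -- Such a c is
  -- precisely an h-linear combination of distinct elements a_i (with nonzero
  -- coefficients), taken up to permutation of the summands.
  HasSupport : ∀ {n} → ℕ → (Fin n → Carrier) → Set ℓ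
  HasSupport {n} h c = Σ (Subset n) λ S → (∣ S ∣ ≡ h) ×
    (∀ i → (i ∈ S → ¬ (c i ≈ 0#)) × (i ∉ S → c i ≈ 0#))

  -- a finite subset A of F_q^r, given as an injective family a : Fin n → F_q^r
  -- (so |A| = n)
  Distinct : ∀ {n r} → (Fin n → Vect r) → Set ℓ
  Distinct {n} a = ∀ i j → a i ≈ᵥ a j → i ≡ j

  IsShLinear : ∀ {n r} → ℕ → (Fin n → Vect r) → Set (c ⊔ ℓ)
  IsShLinear {n} h a = Distinct a × (h ≤ n) ×
    (∀ (γ δ : Fin n → Carrier) → HasSupport h γ → HasSupport h δ →
       lincomb γ a ≈ᵥ lincomb δ a → ∀ i → γ i ≈ δ i)

  IsMaximalShLinear : ∀ {n r} → ℕ → (Fin n → Vect r) → Set (c ⊔ ℓ)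
  IsMaximalShLinear {n} {r} h a = IsShLinear h a ×
    (∀ (m : ℕ) (b : Fin m → Vect r) → IsShLinear h b →
       (∀ i → ∃ λ j → a i ≈ᵥ b j) → ∀ j → ∃ λ i → b j ≈ᵥ a i)

  SupportedOn : ∀ {n} → Subset n → (Fin n → Carrier) → Set ℓ
  SupportedOn S γ = ∀ i → i ∉ S → γ i ≈ 0#

  IsBasis : ∀ {n r} → (Fin n → Vect r) → Subset n → Set (c ⊔ ℓ)
  IsBasis {n} {r} a S =
    (∀ γ → SupportedOn S γ → lincomb γ a ≈ᵥ zeroᵥ → ∀ i → γ i ≈ 0#) ×
    (∀ (v : Vect r) → ∃ λ γ → SupportedOn S γ × lincomb γ a ≈ᵥ v)

  ContainsBasis : ∀ {n r} → (Fin n → Vect r) → Set (c ⊔ ℓ)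
  ContainsBasis {n} a = ∃ λ (S : Subset n) → IsBasis a S

-- If A is S_h-linear and v lies outside the span of A, then A ∪ {v} is still
-- S_h-linear: in an equality of two h-combinations of A ∪ {v}, different
-- coefficients of v would put v in the span of A, and equal ones cancel,
-- leaving two h- or two (h-1)-combinations of A.  A is also S_{h-1}-linear as
-- soon as 2(h-1) < |A|, since a common fresh summand turns two
-- (h-1)-combinations into h-combinations.  Hence a maximal A spans F_q^r, and
-- a spanning set contains a basis: discard vectors occurring with a nonzero
-- coefficient in a linear relation until none is left.
module Submission where

open import Level using (Level; _⊔_)
open import Data.Nat as ℕ using (ℕ; _≤_; _<_; z≤n; s≤s)
import Data.Nat.Properties as ℕ
open import Data.Nat.Induction using (<-wellFounded)
open import Induction.WellFounded using (Acc; acc)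
open import Data.Fin as Fin using (Fin; zero; suc)
import Data.Fin.Properties as Fin
open import Data.Fin.Subset using (Subset; inside; outside; _∈_; _∉_; ∣_∣; _∪_; ⁅_⁆; _-_; ⊤)
open import Data.Fin.Subset.Properties
  using (_∈?_; drop-there; ∈⊤; ∪-identityʳ; x∈⁅x⁆; x∈⁅y⁆⇒x≡y; x∈p∪q⁺; x∈p∪q⁻; x∈p∧x≢y⇒x∈p-y; x∈p⇒∣p-x∣<∣p∣)
open import Data.Vec.Base using ([]; _∷_; here; there)
open import Data.Vec.Functional as Vector using (Vector; head; tail; removeAt)
open import Data.Product using (∃; _×_; _,_; proj₁; proj₂)
open import Data.Sum using (inj₁; inj₂; [_,_]′)
open import Function using (_∘_; id)
open import Function.Bundles using (Inverse)
open import Function.Properties.Inverse using (Inverse⇒Injection)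
open import Relation.Nullary using (¬_; Dec; yes; no; contradiction; ¬?)
open import Relation.Nullary.Decidable using (via-injection; map′; decidable-stable; _→-dec_; _×-dec_)
open import Relation.Binary.PropositionalEquality as ≡ using (_≡_; _≢_)
open import Defs

∣p∪q∣≤∣p∣+∣q∣ : ∀ {n} (p q : Subset n) → ∣ p ∪ q ∣ ≤ ∣ p ∣ ℕ.+ ∣ q ∣
∣p∪q∣≤∣p∣+∣q∣ []            []            = z≤n
∣p∪q∣≤∣p∣+∣q∣ (inside  ∷ p) (inside  ∷ q) =
  s≤s (ℕ.≤-trans (∣p∪q∣≤∣p∣+∣q∣ p q) (ℕ.+-monoʳ-≤ ∣ p ∣ (ℕ.n≤1+n ∣ q ∣)))
∣p∪q∣≤∣p∣+∣q∣ (inside  ∷ p) (outside ∷ q) = s≤s (∣p∪q∣≤∣p∣+∣q∣ p q)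
∣p∪q∣≤∣p∣+∣q∣ (outside ∷ p) (inside  ∷ q) =
  ℕ.≤-trans (s≤s (∣p∪q∣≤∣p∣+∣q∣ p q)) (ℕ.≤-reflexive (≡.sym (ℕ.+-suc ∣ p ∣ ∣ q ∣)))
∣p∪q∣≤∣p∣+∣q∣ (outside ∷ p) (outside ∷ q) = ∣p∪q∣≤∣p∣+∣q∣ p q

x∉p⇒∣p∪⁅x⁆∣≡1+∣p∣ : ∀ {n} (p : Subset n) x → x ∉ p → ∣ p ∪ ⁅ x ⁆ ∣ ≡ ℕ.suc ∣ p ∣
x∉p⇒∣p∪⁅x⁆∣≡1+∣p∣ (inside  ∷ p) zero    x∉p = contradiction here x∉p
x∉p⇒∣p∪⁅x⁆∣≡1+∣p∣ (outside ∷ p) zero    _   = ≡.cong (ℕ.suc ∘ ∣_∣) (∪-identityʳ p)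
x∉p⇒∣p∪⁅x⁆∣≡1+∣p∣ (inside  ∷ p) (suc x) x∉p = ≡.cong ℕ.suc (x∉p⇒∣p∪⁅x⁆∣≡1+∣p∣ p x (x∉p ∘ there))
x∉p⇒∣p∪⁅x⁆∣≡1+∣p∣ (outside ∷ p) (suc x) x∉p = x∉p⇒∣p∪⁅x⁆∣≡1+∣p∣ p x (x∉p ∘ there)

∣p∣<n⇒∃∉ : ∀ {n} (p : Subset n) → ∣ p ∣ < n → ∃ λ x → x ∉ p
∣p∣<n⇒∃∉ (outside ∷ p) _           = zero , λ ()
∣p∣<n⇒∃∉ (inside  ∷ p) (s≤s ∣p∣<n) =
  let x , x∉p = ∣p∣<n⇒∃∉ p ∣p∣<n in suc x , x∉p ∘ drop-there

∣p∣+∣q∣<n⇒∃∉p∪q : ∀ {n} (p q : Subset n) → ∣ p ∣ ℕ.+ ∣ q ∣ < n → ∃ λ x → x ∉ p ∪ q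
∣p∣+∣q∣<n⇒∃∉p∪q p q ∣p∣+∣q∣<n = ∣p∣<n⇒∃∉ (p ∪ q) (ℕ.≤-<-trans (∣p∪q∣≤∣p∣+∣q∣ p q) ∣p∣+∣q∣<n)

module _ {c ℓ : Level} (F : FiniteField c ℓ) where
  open FiniteField F hiding (zero; _-_)
  open FF F
  open import Algebra.Properties.Semiring.Sum semiring
    using (sum; sum-cong-≋; ∑-distrib-+; *-distribˡ-sum; sum-remove; sum-replicate-zero)
  open import Algebra.Properties.Ring ring using (-‿distribˡ-*; -‿distribʳ-*; [y-z]x≈yx-zx)
  open import Algebra.Properties.AbelianGroup +-abelianGroup using (⁻¹-∙-comm)
  open import Algebra.Properties.Group +-group using ()
    renaming (∙-cancelˡ to +-cancelˡ; ∙-cancelʳ to +-cancelʳ; x∙y⁻¹≈ε⇒x≈y to x-y≈0⇒x≈y)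
  open import Algebra.Properties.CommutativeSemigroup +-commutativeSemigroup using (interchange)
  open import Relation.Binary.Reasoning.Setoid setoid

  -- Decidability, from the enumeration of the field

  _≟_ : ∀ x y → Dec (x ≈ y)
  _≟_ = via-injection (Inverse⇒Injection enum) Fin._≟_

  _≟ᵥ_ : ∀ {r} (u v : Vect r) → Dec (u ≈ᵥ v)
  u ≟ᵥ v = Fin.all? (λ j → u j ≟ v j)

  any? : ∀ {p} {P : Carrier → Set p} →
         (∀ {x y} → x ≈ y → P x → P y) → (∀ x → Dec (P x)) → Dec (∃ P)
  any? resp P? = map′ (λ (k , Pk) → from k , Pk)
                      (λ (x , Px) → to x , resp (sym (strictlyInverseʳ x)) Px)
                      (Fin.any? (P? ∘ from))
    where open Inverse enum

  anyVector? : ∀ {p} n {P : Vector Carrier n → Set p} →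
               (∀ {γ δ} → (∀ i → γ i ≈ δ i) → P γ → P δ) → (∀ γ → Dec (P γ)) → Dec (∃ P)
  anyVector? ℕ.zero    resp P? = map′ (Vector.[] ,_) (λ (γ , Pγ) → resp (λ ()) Pγ) (P? Vector.[])
  anyVector? (ℕ.suc n) {P} resp P? =
    map′ (λ (γ , x , P[x∷γ]) → x Vector.∷ γ , P[x∷γ])
         (λ (γ , Pγ) → tail γ , head γ , resp (λ { zero → refl ; (suc i) → refl }) Pγ)
         (anyVector? n
           (λ γ≈δ (x , P[x∷γ]) → x , resp (λ { zero → refl ; (suc i) → γ≈δ i }) P[x∷γ])
           (λ γ → any? (λ x≈y → resp (λ { zero → x≈y ; (suc i) → refl })) (λ x → P? (x Vector.∷ γ))))

  sumF≡sum : ∀ n (f : Vector Carrier n) → sumF n f ≡ sum f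
  sumF≡sum ℕ.zero    f = ≡.refl
  sumF≡sum (ℕ.suc n) f = ≡.cong (f zero +_) (sumF≡sum n (tail f))

  lincomb-cong : ∀ {n r} (a : Fin n → Vect r) {γ δ : Vector Carrier n} →
                 (∀ i → γ i ≈ δ i) → lincomb γ a ≈ᵥ lincomb δ a
  lincomb-cong {n} a {γ} {δ} γ≈δ j = begin
    lincomb γ a j                ≡⟨ sumF≡sum n _ ⟩
    sum {n} (λ i → γ i * a i j)  ≈⟨ sum-cong-≋ (λ i → *-congʳ (γ≈δ i)) ⟩
    sum {n} (λ i → δ i * a i j)  ≡⟨ sumF≡sum n _ ⟨
    lincomb δ a j                ∎

  lincomb-+ : ∀ {n r} (γ δ : Vector Carrier n) (a : Fin n → Vect r) →
              lincomb (λ i → γ i + δ i) a ≈ᵥ (λ j → lincomb γ a j + lincomb δ a j)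
  lincomb-+ {n} γ δ a j = begin
    sumF n (λ i → (γ i + δ i) * a i j)             ≡⟨ sumF≡sum n _ ⟩
    sum {n} (λ i → (γ i + δ i) * a i j)            ≈⟨ sum-cong-≋ (λ i → distribʳ (a i j) (γ i) (δ i)) ⟩
    sum {n} (λ i → γ i * a i j + δ i * a i j)      ≈⟨ ∑-distrib-+ {n} _ _ ⟩
    sum {n} (λ i → γ i * a i j) + sum {n} (λ i → δ i * a i j)
      ≡⟨ ≡.cong₂ _+_ (sumF≡sum n _) (sumF≡sum n _) ⟨
    lincomb γ a j + lincomb δ a j                  ∎

  lincomb-* : ∀ {n r} x (γ : Vector Carrier n) (a : Fin n → Vect r) →
              lincomb (λ i → x * γ i) a ≈ᵥ (λ j → x * lincomb γ a j)
  lincomb-* {n} x γ a j = begin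
    sumF n (λ i → (x * γ i) * a i j) ≡⟨ sumF≡sum n _ ⟩
    sum {n} (λ i → (x * γ i) * a i j) ≈⟨ sum-cong-≋ (λ i → *-assoc x (γ i) (a i j)) ⟩
    sum {n} (λ i → x * (γ i * a i j)) ≈⟨ *-distribˡ-sum {n} x _ ⟨
    x * sum {n} (λ i → γ i * a i j)   ≡⟨ ≡.cong (x *_) (sumF≡sum n _) ⟨
    x * lincomb γ a j                ∎

  unitVector : ∀ {n} → Fin n → Vector Carrier n
  unitVector k i with i Fin.≟ k
  ... | yes _ = 1#
  ... | no  _ = 0#

  unitVector-self : ∀ {n} (k : Fin n) → unitVector k k ≈ 1#
  unitVector-self k with k Fin.≟ k
  ... | yes _   = refl
  ... | no  k≢k = contradiction ≡.refl k≢k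

  unitVector-other : ∀ {n} {k i : Fin n} → i ≢ k → unitVector k i ≈ 0#
  unitVector-other {k = k} {i} i≢k with i Fin.≟ k
  ... | yes i≡k = contradiction i≡k i≢k
  ... | no  _   = refl

  lincomb-unitVector : ∀ {n r} (a : Fin n → Vect r) k → lincomb (unitVector k) a ≈ᵥ a k
  lincomb-unitVector {ℕ.suc n} a k j = begin
    sumF _ t                           ≡⟨ sumF≡sum _ t ⟩
    sum t                              ≈⟨ sum-remove {i = k} t ⟩
    t k + sum (removeAt t k)           ≈⟨ +-cong (*-congʳ (unitVector-self k)) others-vanish ⟩
    1# * a k j + 0#                    ≈⟨ +-identityʳ _ ⟩
    1# * a k j                         ≈⟨ *-identityˡ (a k j) ⟩
    a k j                              ∎
    where
    t : Vector Carrier (ℕ.suc n)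
    t i = unitVector k i * a i j
    others-vanish : sum (removeAt t k) ≈ 0#
    others-vanish = trans
      (sum-cong-≋ (λ i → trans (*-congʳ (unitVector-other (Fin.punchInᵢ≢i k i))) (zeroˡ _)))
      (sum-replicate-zero n)

  InSpan : ∀ {n r} → (Fin n → Vect r) → Vect r → Set (c ⊔ ℓ)
  InSpan a v = ∃ λ γ → lincomb γ a ≈ᵥ v

  inSpan? : ∀ {n r} (a : Fin n → Vect r) v → Dec (InSpan a v)
  inSpan? {n} a v = anyVector? n (λ γ≈δ γa≈v j → trans (sym (lincomb-cong a γ≈δ j)) (γa≈v j))
                                 (λ γ → lincomb γ a ≟ᵥ v)

  member-inSpan : ∀ {n r} (a : Fin n → Vect r) {v} k → v ≈ᵥ a k → InSpan a v
  member-inSpan a k v≈aₖ = unitVector k , λ j → trans (lincomb-unitVector a k j) (sym (v≈aₖ j))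

  [x+z]-[y+z]≈x-y : ∀ x y z → (x + z) + - (y + z) ≈ x + - y
  [x+z]-[y+z]≈x-y x y z = begin
    (x + z) + - (y + z)   ≈⟨ +-congˡ (⁻¹-∙-comm y z) ⟨
    (x + z) + (- y + - z) ≈⟨ interchange x z (- y) (- z) ⟩
    (x + - y) + (z + - z) ≈⟨ +-congˡ (-‿inverseʳ z) ⟩
    (x + - y) + 0#        ≈⟨ +-identityʳ _ ⟩
    x + - y               ∎

  x+z≈y+w⇒x-y≈w-z : ∀ {x y z w} → x + z ≈ y + w → x + - y ≈ w + - z
  x+z≈y+w⇒x-y≈w-z {x} {y} {z} {w} x+z≈y+w = begin
    x + - y             ≈⟨ [x+z]-[y+z]≈x-y x y z ⟨
    (x + z) + - (y + z) ≈⟨ +-congʳ x+z≈y+w ⟩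
    (y + w) + - (y + z) ≈⟨ +-cong (+-comm y w) (-‿cong (+-comm y z)) ⟩
    (w + y) + - (z + y) ≈⟨ [x+z]-[y+z]≈x-y w z y ⟩
    w + - z             ∎

  isolate : ∀ {x y e u X Y} → (x + - y) * e ≈ 1# → x * u + X ≈ y * u + Y →
            u ≈ e * Y + (- e) * X
  isolate {x} {y} {e} {u} {X} {Y} inv eq = begin
    u                         ≈⟨ *-identityˡ u ⟨
    1# * u                    ≈⟨ *-congʳ (trans (*-comm e _) inv) ⟨
    (e * (x + - y)) * u       ≈⟨ *-assoc e _ u ⟩
    e * ((x + - y) * u)       ≈⟨ *-congˡ ([y-z]x≈yx-zx u x y) ⟩
    e * (x * u + - (y * u))   ≈⟨ *-congˡ (x+z≈y+w⇒x-y≈w-z eq) ⟩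
    e * (Y + - X)             ≈⟨ distribˡ e Y (- X) ⟩
    e * Y + e * - X           ≈⟨ +-congˡ (trans (sym (-‿distribʳ-* e X)) (-‿distribˡ-* e X)) ⟩
    e * Y + (- e) * X         ∎

  IsSupport : ∀ {n} → Subset n → Vector Carrier n → Set ℓ
  IsSupport S γ = ∀ i → (i ∈ S → ¬ γ i ≈ 0#) × (i ∉ S → γ i ≈ 0#)

  IsSupport-tail : ∀ {n s} {S : Subset n} {γ} → IsSupport (s ∷ S) γ → IsSupport S (tail γ)
  IsSupport-tail γ-supp i = proj₁ (γ-supp (suc i)) ∘ there , λ i∉S → proj₂ (γ-supp (suc i)) (i∉S ∘ drop-there)

  HasSupport-tail₀ : ∀ {n h} {γ : Vector Carrier (ℕ.suc n)} →
                     HasSupport h γ → head γ ≈ 0# → HasSupport h (tail γ)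
  HasSupport-tail₀ (inside  ∷ S , _     , γ-supp) γ₀≈0 = contradiction γ₀≈0 (proj₁ (γ-supp zero) here)
  HasSupport-tail₀ (outside ∷ S , ∣S∣≡h , γ-supp) _    = S , ∣S∣≡h , IsSupport-tail γ-supp

  HasSupport-tail : ∀ {n h} {γ : Vector Carrier (ℕ.suc n)} →
                    HasSupport (ℕ.suc h) γ → ¬ head γ ≈ 0# → HasSupport h (tail γ)
  HasSupport-tail (outside ∷ S , _       , γ-supp) γ₀≉0 = contradiction (proj₂ (γ-supp zero) λ ()) γ₀≉0
  HasSupport-tail (inside  ∷ S , ∣S∣≡1+h , γ-supp) _    = S , ℕ.suc-injective ∣S∣≡1+h , IsSupport-tail γ-supp

  HasSupport-+unitVector : ∀ {n h} {S : Subset n} {γ} k → ∣ S ∣ ≡ h → IsSupport S γ → k ∉ S →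
                           HasSupport (ℕ.suc h) (λ i → γ i + unitVector k i)
  HasSupport-+unitVector {S = S} {γ} k ∣S∣≡h γ-supp k∉S =
    S ∪ ⁅ k ⁆ , ≡.trans (x∉p⇒∣p∪⁅x⁆∣≡1+∣p∣ S k k∉S) (≡.cong ℕ.suc ∣S∣≡h) , supp
    where
    supp : IsSupport (S ∪ ⁅ k ⁆) (λ i → γ i + unitVector k i)
    -- matching on i Fin.≟ k also evaluates unitVector k i to 1# or 0#
    supp i with i Fin.≟ k
    ... | yes ≡.refl = (λ _ γₖ+1≈0 → 0≉1 (sym (trans (sym γₖ+1≈1) γₖ+1≈0)))
                     , (λ k∉ → contradiction (x∈p∪q⁺ (inj₂ (x∈⁅x⁆ k))) k∉)
      where
      γₖ+1≈1 : γ k + 1# ≈ 1#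
      γₖ+1≈1 = trans (+-congʳ (proj₂ (γ-supp k) k∉S)) (+-identityˡ 1#)
    ... | no  i≢k = (λ i∈ γᵢ+0≈0 → proj₁ (γ-supp i) (∈S i∈) (trans (sym (+-identityʳ (γ i))) γᵢ+0≈0))
                  , (λ i∉ → trans (+-identityʳ (γ i)) (proj₂ (γ-supp i) (i∉ ∘ x∈p∪q⁺ ∘ inj₁)))
      where
      ∈S : i ∈ S ∪ ⁅ k ⁆ → i ∈ S
      ∈S i∈ = [ id , (λ i∈⁅k⁆ → contradiction (x∈⁅y⁆⇒x≡y k i∈⁅k⁆) i≢k) ]′ (x∈p∪q⁻ S ⁅ k ⁆ i∈)

  ShInjective : ∀ {n r} → ℕ → (Fin n → Vect r) → Set (c ⊔ ℓ)
  ShInjective h a = ∀ (γ δ : Vector Carrier _) → HasSupport h γ → HasSupport h δ →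
                    lincomb γ a ≈ᵥ lincomb δ a → ∀ i → γ i ≈ δ i

  ShInjective-pred : ∀ {n r h} {a : Fin n → Vect r} →
                     h ℕ.+ h < n → ShInjective (ℕ.suc h) a → ShInjective h a
  ShInjective-pred {n} {a = a} h+h<n inj γ δ (S , ∣S∣≡h , γ-supp) (T , ∣T∣≡h , δ-supp) γa≈δa
    with ∣p∣+∣q∣<n⇒∃∉p∪q S T (≡.subst (_< n) (≡.cong₂ ℕ._+_ (≡.sym ∣S∣≡h) (≡.sym ∣T∣≡h)) h+h<n)
  ... | k , k∉S∪T = λ i → +-cancelʳ (unitVector k i) (γ i) (δ i)
    (inj _ _ (HasSupport-+unitVector k ∣S∣≡h γ-supp (k∉S∪T ∘ x∈p∪q⁺ ∘ inj₁))
             (HasSupport-+unitVector k ∣T∣≡h δ-supp (k∉S∪T ∘ x∈p∪q⁺ ∘ inj₂))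
             shifted i)
    where
    shifted : lincomb (λ i → γ i + unitVector k i) a ≈ᵥ lincomb (λ i → δ i + unitVector k i) a
    shifted j = begin
      lincomb (λ i → γ i + unitVector k i) a j ≈⟨ lincomb-+ γ (unitVector k) a j ⟩
      lincomb γ a j + lincomb (unitVector k) a j ≈⟨ +-cong (γa≈δa j) refl ⟩
      lincomb δ a j + lincomb (unitVector k) a j ≈⟨ lincomb-+ δ (unitVector k) a j ⟨
      lincomb (λ i → δ i + unitVector k i) a j ∎

  Distinct-∷ : ∀ {n r} {a : Fin n → Vect r} {v} → ¬ InSpan a v → Distinct a → Distinct (v Vector.∷ a)
  Distinct-∷         v∉ a-distinct zero    zero    _       = ≡.refl
  Distinct-∷ {a = a} v∉ a-distinct zero    (suc j) v≈aⱼ    = contradiction (member-inSpan a j v≈aⱼ) v∉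
  Distinct-∷ {a = a} v∉ a-distinct (suc i) zero    aᵢ≈v    = contradiction (member-inSpan a i (sym ∘ aᵢ≈v)) v∉
  Distinct-∷         v∉ a-distinct (suc i) (suc j) aᵢ≈aⱼ   = ≡.cong suc (a-distinct i j aᵢ≈aⱼ)

  ShInjective-∷ : ∀ {n r h} {a : Fin n → Vect r} {v} → ¬ InSpan a v →
                  ShInjective h a → ShInjective (ℕ.suc h) a → ShInjective (ℕ.suc h) (v Vector.∷ a)
  ShInjective-∷ {n} {a = a} {v} v∉ inj inj⁺ γ δ γ-supp δ-supp eq with head γ ≟ head δ
  ... | no γ₀≉δ₀ = contradiction (v∈span (inverse (head γ + - head δ) (γ₀≉δ₀ ∘ x-y≈0⇒x≈y _ _))) v∉
    where
    v∈span : (∃ λ e → (head γ + - head δ) * e ≈ 1#) → InSpan a v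
    v∈span (e , e-inv) = (λ i → e * tail δ i + (- e) * tail γ i) , λ j → begin
      lincomb (λ i → e * tail δ i + (- e) * tail γ i) a j
        ≈⟨ lincomb-+ _ _ a j ⟩
      lincomb (λ i → e * tail δ i) a j + lincomb (λ i → (- e) * tail γ i) a j
        ≈⟨ +-cong (lincomb-* e (tail δ) a j) (lincomb-* (- e) (tail γ) a j) ⟩
      e * lincomb (tail δ) a j + (- e) * lincomb (tail γ) a j
        ≈⟨ isolate e-inv (eq j) ⟨
      v j ∎
  ... | yes γ₀≈δ₀ = λ { zero → γ₀≈δ₀ ; (suc i) → tails-agree i }
    where
    tail-combinations-agree : lincomb (tail γ) a ≈ᵥ lincomb (tail δ) a
    tail-combinations-agree j = +-cancelˡ (head γ * v j) _ _ (trans (eq j) (+-congʳ (*-congʳ (sym γ₀≈δ₀))))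
    tails-agree : ∀ i → tail γ i ≈ tail δ i
    tails-agree with head γ ≟ 0#
    ... | yes γ₀≈0 = inj⁺ _ _ (HasSupport-tail₀ γ-supp γ₀≈0)
                               (HasSupport-tail₀ δ-supp (trans (sym γ₀≈δ₀) γ₀≈0)) tail-combinations-agree
    ... | no  γ₀≉0 = inj _ _ (HasSupport-tail γ-supp γ₀≉0)
                             (HasSupport-tail δ-supp (γ₀≉0 ∘ trans γ₀≈δ₀)) tail-combinations-agree

  IsShLinear-∷ : ∀ {n r h} {a : Fin n → Vect r} {v} → ¬ InSpan a v →
                 ShInjective h a → IsShLinear (ℕ.suc h) a → IsShLinear (ℕ.suc h) (v Vector.∷ a)
  IsShLinear-∷ v∉ inj (a-distinct , h≤n , inj⁺) =
    Distinct-∷ v∉ a-distinct , ℕ.m≤n⇒m≤1+n h≤n , ShInjective-∷ v∉ inj inj⁺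

  IsMaximalShLinear⇒spans : ∀ {n r h} {a : Fin n → Vect r} →
                            h ℕ.+ h < n → IsMaximalShLinear (ℕ.suc h) a → ∀ v → InSpan a v
  IsMaximalShLinear⇒spans {n} {a = a} h+h<n (a-linear@(_ , _ , inj⁺) , maximal) v with inSpan? a v
  ... | yes v∈ = v∈
  ... | no  v∉
    with maximal (ℕ.suc n) (v Vector.∷ a) (IsShLinear-∷ v∉ (ShInjective-pred h+h<n inj⁺) a-linear)
                 (λ i → suc i , λ _ → refl) zero
  ...   | i , v≈aᵢ = contradiction (member-inSpan a i v≈aᵢ) v∉

  module _ {n r} (a : Fin n → Vect r) where

    Spans : Subset n → Set (c ⊔ ℓ)
    Spans S = ∀ v → ∃ λ γ → SupportedOn S γ × lincomb γ a ≈ᵥ v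

    NontrivialRelation : Subset n → Vector Carrier n → Set ℓ
    NontrivialRelation S γ = SupportedOn S γ × lincomb γ a ≈ᵥ zeroᵥ × ∃ λ i → ¬ γ i ≈ 0#

    nontrivialRelation? : ∀ S → Dec (∃ (NontrivialRelation S))
    nontrivialRelation? S = anyVector? n resp (λ γ → supportedOn? γ ×-dec (lincomb γ a ≟ᵥ zeroᵥ)
                                                       ×-dec Fin.any? (λ i → ¬? (γ i ≟ 0#)))
      where
      supportedOn? : ∀ γ → Dec (SupportedOn S γ)
      supportedOn? γ = Fin.all? (λ i → ¬? (i ∈? S) →-dec (γ i ≟ 0#))
      resp : ∀ {γ δ} → (∀ i → γ i ≈ δ i) → NontrivialRelation S γ → NontrivialRelation S δ
      resp γ≈δ (γ-supp , γa≈0 , i , γᵢ≉0) =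
        (λ i i∉S → trans (sym (γ≈δ i)) (γ-supp i i∉S)) ,
        (λ j → trans (sym (lincomb-cong a γ≈δ j)) (γa≈0 j)) ,
        i , γᵢ≉0 ∘ trans (γ≈δ i)

    Spans-remove : ∀ {S γ i} → SupportedOn S γ → lincomb γ a ≈ᵥ zeroᵥ → ¬ γ i ≈ 0# →
                   Spans S → Spans (S - i)
    Spans-remove {S} {γ} {i} γ-supp γa≈0 γᵢ≉0 spans v with spans v | inverse (γ i) γᵢ≉0
    ... | δ , δ-supp , δa≈v | e , γᵢe≈1 = δ′ , δ′-supp , δ′a≈v
      where
      k : Carrier
      k = (- δ i) * e
      δ′ : Vector Carrier n
      δ′ t = δ t + k * γ t
      δ′a≈v : lincomb δ′ a ≈ᵥ v
      δ′a≈v j = begin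
        lincomb δ′ a j                              ≈⟨ lincomb-+ δ (λ t → k * γ t) a j ⟩
        lincomb δ a j + lincomb (λ t → k * γ t) a j ≈⟨ +-cong (δa≈v j) (lincomb-* k γ a j) ⟩
        v j + k * lincomb γ a j                     ≈⟨ +-congˡ (trans (*-congˡ (γa≈0 j)) (zeroʳ k)) ⟩
        v j + 0#                                    ≈⟨ +-identityʳ (v j) ⟩
        v j                                         ∎
      δ′ᵢ≈0 : δ′ i ≈ 0#
      δ′ᵢ≈0 = begin
        δ i + ((- δ i) * e) * γ i ≈⟨ +-congˡ (*-assoc (- δ i) e (γ i)) ⟩
        δ i + (- δ i) * (e * γ i) ≈⟨ +-congˡ (*-congˡ (trans (*-comm e (γ i)) γᵢe≈1)) ⟩
        δ i + (- δ i) * 1#        ≈⟨ +-congˡ (*-identityʳ (- δ i)) ⟩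
        δ i + - δ i               ≈⟨ -‿inverseʳ (δ i) ⟩
        0#                        ∎
      δ′-supp : SupportedOn (S - i) δ′
      δ′-supp t t∉S-i with t Fin.≟ i
      ... | yes ≡.refl = δ′ᵢ≈0
      ... | no  t≢i    = trans (+-cong (δ-supp t t∉S) (trans (*-congˡ (γ-supp t t∉S)) (zeroʳ k))) (+-identityʳ 0#)
        where
        t∉S : t ∉ S
        t∉S t∈S = t∉S-i (x∈p∧x≢y⇒x∈p-y t∈S t≢i)

    Spans⇒ContainsBasis : ∀ S → Spans S → ContainsBasis a
    Spans⇒ContainsBasis S = go S (<-wellFounded ∣ S ∣)
      where
      go : ∀ T → Acc _<_ ∣ T ∣ → Spans T → ContainsBasis a
      go T (acc smaller) spans with nontrivialRelation? T
      ... | no ∄relation = T , independent , spans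
        where
        independent : ∀ γ → SupportedOn T γ → lincomb γ a ≈ᵥ zeroᵥ → ∀ i → γ i ≈ 0#
        independent γ γ-supp γa≈0 i =
          decidable-stable (γ i ≟ 0#) (λ γᵢ≉0 → ∄relation (γ , γ-supp , γa≈0 , i , γᵢ≉0))
      ... | yes (γ , γ-supp , γa≈0 , i , γᵢ≉0) =
        go (T - i) (smaller (x∈p⇒∣p-x∣<∣p∣ i∈T)) (Spans-remove γ-supp γa≈0 γᵢ≉0 spans)
        where
        i∈T : i ∈ T
        i∈T = decidable-stable (i ∈? T) (γᵢ≉0 ∘ γ-supp i)

-- Only now, since in the field module above _*_ is the field multiplication.
open import Data.Nat using (_*_)

lemma3p14 : ∀ {c ℓ : Level} (F : FiniteField c ℓ) {h r n : ℕ}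
    (a : Fin n → FF.Vect F r) →
    1 ≤ h → 2 * h < r → r ≤ n →
    FF.IsMaximalShLinear F h a →
    FF.ContainsBasis F a
lemma3p14 F {ℕ.suc h} {r} {n} a (s≤s _) 2[1+h]<r r≤n maximal =
  Spans⇒ContainsBasis F a ⊤ λ v →
    let γ , γa≈v = IsMaximalShLinear⇒spans F h+h<n maximal v
    in γ , (λ i i∉⊤ → contradiction ∈⊤ i∉⊤) , γa≈v
  where
  open ℕ.≤-Reasoning
  h+h<n : h ℕ.+ h < n
  h+h<n = begin-strict
    h ℕ.+ h      ≡⟨ ≡.cong (h ℕ.+_) (ℕ.+-identityʳ h) ⟨
    2 * h        <⟨ ℕ.*-monoʳ-< 2 (ℕ.n<1+n h) ⟩
    2 * ℕ.suc h  <⟨ 2[1+h]<r ⟩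
    r            ≤⟨ r≤n ⟩
    n            ∎
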